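{- Let $\phi,\psi\in\mathcal{L}_C$ and assume that the sequent $\vdash\phi,\psi$ is derivable in DBL$_\ast$. Then $\vdash_C\phi$ or $\vdash_C\psi$.
   Context: Fix a finite set $\Theta$ of atomic propositions and $\theta_1\in\Theta$. $\mathcal{L}$ is the smallest set containing $\Theta$ and closed under $\neg\phi$, $\phi\rightarrow\psi$, $(\psi|\phi)$; $\mathcal{L}_C\subset\mathcal{L}$ is the smallest set containing $\Theta$ and closed under $\neg$ and $\rightarrow$ only. Abbreviations: $\phi\vee\psi:=\neg\phi\rightarrow\psi$, $\phi\wedge\psi:=\neg(\neg\phi\vee\neg\psi)$, $\phi\leftrightarrow\psi:=(\phi\rightarrow\psi)\wedge(\psi\rightarrow\phi)$, $\psi\times\phi:=(\psi|\phi)\leftrightarrow\psi$, $\top:=\theta_1\rightarrow\theta_1$, $\bot:=\neg\top$. A sequent is a pair of finite (possibly empty) sequences $\Gamma,\Delta$ of formulas, written $\Gamma\vdash\Delta$ (the right side lists alternatives, not a disjunction); $\{\Gamma\}$ is the set of entries of $\Gamma$. The classical system $\mathcal{C}$ is the smallest set of sequents closed under (CUT) from $\Gamma\vdash\Delta,\phi$ and $\Lambda,\phi\vdash\Sigma$ infer $\Gamma,\Lambda\vdash\Delta,\Sigma$, and (STRUCT) if $\{\Gamma\}\subset\{\Lambda\}\cup\{\top\}$, $\{\Delta\}\subset\{\Sigma\}\cup\{\bot\}$, from $\Gamma\vdash\Delta$ infer $\Lambda\vdash\Sigma$, and containing for all $\phi,\psi,\eta$: $\phi,\phi\rightarrow\psi\vdash\psi$;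 $\vdash\phi\rightarrow(\psi\rightarrow\phi)$; $\vdash(\eta\rightarrow(\phi\rightarrow\psi))\rightarrow((\eta\rightarrow\phi)\rightarrow(\eta\rightarrow\psi))$; $\vdash(\neg\phi\rightarrow\neg\psi)\rightarrow((\neg\phi\rightarrow\psi)\rightarrow\phi)$; derivability in it is written $\vdash_C$. DBL$_\ast$ is the smallest set of sequents with the same closure conditions and axioms, and additionally containing for all $\phi,\psi,\eta$: $\phi\rightarrow\psi\vdash\neg\phi,(\psi|\phi)$; $\vdash(\psi\rightarrow\eta|\phi)\rightarrow((\psi|\phi)\rightarrow(\eta|\phi))$; $\vdash(\psi|\phi)\rightarrow(\phi\rightarrow\psi)$; $\vdash\neg(\neg\psi|\phi)\leftrightarrow(\psi|\phi)$; $\psi\times\neg\phi\vdash\psi\times\phi$; $\psi\times\phi\vdash\psi\times\neg\phi$; $\psi\leftrightarrow\eta\vdash(\phi|\psi)\leftrightarrow(\phi|\eta)$. -}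

module Defs where

open import Data.Nat using (ℕ; suc)
open import Data.Fin using (Fin; zero)
open import Data.List using (List; []; _∷_; _++_)
open import Data.List.Membership.Propositional using (_∈_)
open import Data.Sum using (_⊎_)
open import Relation.Binary.PropositionalEquality using (_≡_)

-- Θ = Fin (suc n) (a finite, nonempty set of atoms); θ₁ = zero.
data Form (n : ℕ) : Set where
  atom : Fin (suc n) → Form n
  ¬'_  : Form n → Form n
  _⇒_  : Form n → Form n → Form n
  _∣_  : Form n → Form n → Form n

infixr 5 _⇒_
infix 9 ¬'_

module _ {n : ℕ} where
  _∨'_ _∧'_ _⇔_ _×'_ : Form n → Form n → Form n
  φ ∨' ψ = (¬' φ) ⇒ ψ
  φ ∧' ψ = ¬' ((¬' φ) ∨' (¬' ψ))
  φ ⇔ ψ = (φ ⇒ ψ) ∧' (ψ ⇒ φ)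
  ψ ×' φ = (ψ ∣ φ) ⇔ ψ

  ⊤' ⊥' : Form n
  ⊤' = atom zero ⇒ atom zero
  ⊥' = ¬' ⊤'

data Classical {n : ℕ} : Form n → Set where
  atom : ∀ i → Classical (atom i)
  neg  : ∀ {φ} → Classical φ → Classical (¬' φ)
  imp  : ∀ {φ ψ} → Classical φ → Classical ψ → Classical (φ ⇒ ψ)

data DBLAx {n : ℕ} : List (Form n) → List (Form n) → Set where
  d1 : ∀ φ ψ → DBLAx ((φ ⇒ ψ) ∷ []) ((¬' φ) ∷ (ψ ∣ φ) ∷ [])
  d2 : ∀ φ ψ η → DBLAx [] ((((ψ ⇒ η) ∣ φ) ⇒ ((ψ ∣ φ) ⇒ (η ∣ φ))) ∷ [])
  d3 : ∀ φ ψ → DBLAx [] (((ψ ∣ φ) ⇒ (φ ⇒ ψ)) ∷ [])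
  d4 : ∀ φ ψ → DBLAx [] (((¬' ((¬' ψ) ∣ φ)) ⇔ (ψ ∣ φ)) ∷ [])
  d5 : ∀ φ ψ → DBLAx ((ψ ×' (¬' φ)) ∷ []) ((ψ ×' φ) ∷ [])
  d6 : ∀ φ ψ → DBLAx ((ψ ×' φ) ∷ []) ((ψ ×' (¬' φ)) ∷ [])
  d7 : ∀ φ ψ η → DBLAx ((ψ ⇔ η) ∷ []) (((φ ∣ ψ) ⇔ (φ ∣ η)) ∷ [])

data NoAx {n : ℕ} : List (Form n) → List (Form n) → Set where

data Derivable {n : ℕ} (Ax : List (Form n) → List (Form n) → Set)
     : List (Form n) → List (Form n) → Set where
  extra  : ∀ {Γ Δ} → Ax Γ Δ → Derivable Ax Γ Δ
  mp     : ∀ φ ψ → Derivable Ax (φ ∷ (φ ⇒ ψ) ∷ []) (ψ ∷ [])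
  k      : ∀ φ ψ → Derivable Ax [] ((φ ⇒ (ψ ⇒ φ)) ∷ [])
  s      : ∀ φ ψ η → Derivable Ax []
             (((η ⇒ (φ ⇒ ψ)) ⇒ ((η ⇒ φ) ⇒ (η ⇒ ψ))) ∷ [])
  contra : ∀ φ ψ → Derivable Ax []
             ((((¬' φ) ⇒ (¬' ψ)) ⇒ (((¬' φ) ⇒ ψ) ⇒ φ)) ∷ [])
  cut    : ∀ {Γ Δ Λ Σ} φ → Derivable Ax Γ (Δ ++ φ ∷ [])
             → Derivable Ax (Λ ++ φ ∷ []) Σ
             → Derivable Ax (Γ ++ Λ) (Δ ++ Σ)
  struct : ∀ {Γ Δ Λ Σ}
             → (∀ {x} → x ∈ Γ → x ∈ Λ ⊎ x ≡ ⊤')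
             → (∀ {x} → x ∈ Δ → x ∈ Σ ⊎ x ≡ ⊥')
             → Derivable Ax Γ Δ → Derivable Ax Λ Σ

_⊢C_ : ∀ {n} → List (Form n) → List (Form n) → Set
Γ ⊢C Δ = Derivable NoAx Γ Δ

_⊢DBL_ : ∀ {n} → List (Form n) → List (Form n) → Set
Γ ⊢DBL Δ = Derivable DBLAx Γ Δ

{-# OPTIONS --safe #-}
-- Interpret DBL* in two-world models: a pair of classical valuations, one per world
-- (the worlds are `true` and `false`, and `not w` is the other world), where (ψ|φ) holds
-- at w iff ψ holds at the φ-world closest to w: w itself if φ holds there, else the other
-- world if φ holds there, else w. Designating the formulas true at both worlds gives a
-- model of every axiom and rule of DBL*. A classical formula is evaluated in each world
-- separately, so if a valuation u refutes φ, soundness of ⊢ φ, ψ in the model (u, v)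
-- makes ψ true under every v; hence ψ is a tautology, and Kalmár's completeness argument
-- derives it in C.
module Submission where

open import Defs
open import Data.Bool using (Bool; true; false; not; _∨_; if_then_else_)
open import Data.Bool.Properties
  using (∨-inverseˡ; ∨-zeroʳ; not-involutive; ¬-not) renaming (_≟_ to _≟ᵇ_)
open import Data.Fin using (Fin; zero)
open import Data.Fin.Subset.Properties using (anySubset?)
open import Data.List using (List; []; _∷_; map; allFin)
open import Data.List.Membership.Propositional using (_∈_; find; lose)
open import Data.List.Membership.Propositional.Properties using (∈-map⁺; ∈-allFin)
open import Data.List.Relation.Unary.All as All using (All; []; _∷_)
import Data.List.Relation.Unary.All.Properties as All
open import Data.List.Relation.Unary.Any using (Any; here; there)
import Data.List.Relation.Unary.Any.Properties as Any
open import Data.List.Relation.Unary.Unique.Propositional using (Unique; []; _∷_)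
open import Data.List.Relation.Unary.Unique.Propositional.Properties using (allFin⁺)
open import Data.Nat using (ℕ; suc)
open import Data.Product using (∃; _,_)
open import Data.Sum using (_⊎_; inj₁; inj₂; [_,_]′)
open import Data.Vec using (Vec; lookup; replicate; _[_]≔_)
open import Data.Vec.Properties using (lookup∘update; lookup∘update′)
open import Function using (_∘_)
open import Relation.Binary.PropositionalEquality
  using (_≡_; _≢_; refl; sym; trans; cong; cong₂; subst)
open import Relation.Nullary using (¬_; yes; no; contradiction)

private
  variable
    n : ℕ
    φ ψ η : Form n
    Γ Δ : List (Form n)

record IsModel (Ax : List (Form n) → List (Form n) → Set) (⊨_ : Form n → Set) : Set where
  field
    ⊨-mp     : ∀ {φ ψ} → ⊨ φ → ⊨ (φ ⇒ ψ) → ⊨ ψ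
    ⊨-k      : ∀ {φ ψ} → ⊨ (φ ⇒ ψ ⇒ φ)
    ⊨-s      : ∀ {φ ψ η} → ⊨ ((η ⇒ φ ⇒ ψ) ⇒ (η ⇒ φ) ⇒ η ⇒ ψ)
    ⊨-contra : ∀ {φ ψ} → ⊨ ((¬' φ ⇒ ¬' ψ) ⇒ (¬' φ ⇒ ψ) ⇒ φ)
    ⊭⊥       : ¬ ⊨ ⊥'
    ⊨-axiom  : ∀ {Γ Δ} → Ax Γ Δ → All ⊨_ Γ → Any ⊨_ Δ

module _ {Ax : List (Form n) → List (Form n) → Set} {⊨_ : Form n → Set}
         (M : IsModel Ax ⊨_) where
  open IsModel M

  ⊨-⊤ : ⊨ ⊤'
  ⊨-⊤ = ⊨-mp (⊨-k {ψ = ⊤'}) (⊨-mp ⊨-k ⊨-s)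

  soundness : Derivable Ax Γ Δ → All ⊨_ Γ → Any ⊨_ Δ
  soundness (extra ax)   = ⊨-axiom ax
  soundness (mp φ ψ) (⊨φ ∷ ⊨φ⇒ψ ∷ []) = here (⊨-mp ⊨φ ⊨φ⇒ψ)
  soundness (k φ ψ)      _ = here ⊨-k
  soundness (s φ ψ η)    _ = here ⊨-s
  soundness (contra φ ψ) _ = here ⊨-contra
  soundness (cut {Γ} {Δ} φ d e) ⊨ΓΛ with Any.++⁻ Δ (soundness d (All.++⁻ˡ Γ ⊨ΓΛ))
  ... | inj₁ ⊨Δ        = Any.++⁺ˡ ⊨Δ
  ... | inj₂ (here ⊨φ) = Any.++⁺ʳ Δ (soundness e (All.++⁺ (All.++⁻ʳ Γ ⊨ΓΛ) (⊨φ ∷ [])))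
  soundness (struct Γ⊆Λ Δ⊆Σ d) ⊨Λ
    with find (soundness d (All.tabulate λ x∈Γ →
                 [ All.lookup ⊨Λ , (λ { refl → ⊨-⊤ }) ]′ (Γ⊆Λ x∈Γ)))
  ... | _ , x∈Δ , ⊨x with Δ⊆Σ x∈Δ
  ...   | inj₁ x∈Σ = lose x∈Σ ⊨x
  ...   | inj₂ refl = contradiction ⊨x ⊭⊥

World : Set
World = Bool

Valuation : ℕ → Set
Valuation n = Vec Bool (suc n)

closest : (World → Bool) → World → World
closest P w = if P w then w else if P (not w) then not w else w

closest-satisfies : ∀ (P : World → Bool) u w → P u ≡ true → P (closest P w) ≡ true
closest-satisfies P u w Pu with P w in Pw | P (not w) in P¬w
... | true  | _     = Pw
... | false | true  = P¬w
closest-satisfies P true  true  Pu | false | false = contradiction (trans (sym Pu) Pw) λ ()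
closest-satisfies P false false Pu | false | false = contradiction (trans (sym Pu) Pw) λ ()
closest-satisfies P true  false Pu | false | false = contradiction (trans (sym Pu) P¬w) λ ()
closest-satisfies P false true  Pu | false | false = contradiction (trans (sym Pu) P¬w) λ ()

closest-cong : ∀ {P R} → (∀ w → P w ≡ R w) → ∀ w → closest P w ≡ closest R w
closest-cong P≗R w rewrite P≗R w | P≗R (not w) = refl

closest-complement : ∀ P R (Q : World → Bool) → (∀ w → R w ≡ not (P w))
                   → (∀ w → Q (closest R w) ≡ Q w) → ∀ w → Q (closest P w) ≡ Q w
closest-complement P R Q R≡¬P Q∘closestR w with P w in Pw | P (not w) in P¬w
... | true  | _     = refl
... | false | false = refl
... | false | true  = trans (sym (Q∘closestR (not w))) (cong Q R-closest)
  -- P fails at w and holds at `not w`, so R does the opposite and leads from `not w` back to w.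
  where
    R-closest : closest R (not w) ≡ w
    R-closest rewrite R≡¬P (not w) | P¬w | not-involutive w | R≡¬P w | Pw = refl

eval : {φ : Form n} → Valuation n → Classical φ → Bool
eval v (atom i)  = lookup v i
eval v (neg c)   = not (eval v c)
eval v (imp c d) = not (eval v c) ∨ eval v d

module TwoWorlds (V : World → Valuation n) where

  ⟦_⟧ : Form n → World → Bool
  ⟦ atom i ⟧ w = lookup (V w) i
  ⟦ ¬' φ ⟧   w = not (⟦ φ ⟧ w)
  ⟦ φ ⇒ ψ ⟧  w = not (⟦ φ ⟧ w) ∨ ⟦ ψ ⟧ w
  ⟦ ψ ∣ φ ⟧  w = ⟦ ψ ⟧ (closest ⟦ φ ⟧ w)

  record ⊨_ (φ : Form n) : Set where
    constructor everywhere
    field true-at : ∀ w → ⟦ φ ⟧ w ≡ true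
  open ⊨_ public

  ⟦⟧-classical : ∀ (c : Classical φ) w → ⟦ φ ⟧ w ≡ eval (V w) c
  ⟦⟧-classical (atom i)  w = refl
  ⟦⟧-classical (neg c)   w = cong not (⟦⟧-classical c w)
  ⟦⟧-classical (imp c d) w = cong₂ (λ a b → not a ∨ b) (⟦⟧-classical c w) (⟦⟧-classical d w)

  ⇒-elim : ∀ φ ψ {w} → ⟦ φ ⟧ w ≡ true → ⟦ φ ⇒ ψ ⟧ w ≡ true → ⟦ ψ ⟧ w ≡ true
  ⇒-elim φ ψ φ-true φ⇒ψ-true rewrite φ-true = φ⇒ψ-true

  ⇔-intro : ∀ φ ψ w → ⟦ φ ⟧ w ≡ ⟦ ψ ⟧ w → ⟦ φ ⇔ ψ ⟧ w ≡ true
  ⇔-intro φ ψ w φ≡ψ rewrite φ≡ψ with ⟦ ψ ⟧ w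
  ... | true  = refl
  ... | false = refl

  ⇔-elim : ∀ φ ψ w → ⟦ φ ⇔ ψ ⟧ w ≡ true → ⟦ φ ⟧ w ≡ ⟦ ψ ⟧ w
  ⇔-elim φ ψ w φ⇔ψ with ⟦ φ ⟧ w | ⟦ ψ ⟧ w
  ... | true  | true  = refl
  ... | false | false = refl

  ⊨-mp : ⊨ φ → ⊨ (φ ⇒ ψ) → ⊨ ψ
  ⊨-mp {φ = φ} {ψ = ψ} ⊨φ ⊨φ⇒ψ .true-at w = ⇒-elim φ ψ (⊨φ .true-at w) (⊨φ⇒ψ .true-at w)

  ⊨-k : ⊨ (φ ⇒ ψ ⇒ φ)
  ⊨-k {φ = φ} {ψ = ψ} .true-at w with ⟦ φ ⟧ w | ⟦ ψ ⟧ w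
  ... | false | _     = refl
  ... | true  | false = refl
  ... | true  | true  = refl

  ⊨-s : ⊨ ((η ⇒ φ ⇒ ψ) ⇒ (η ⇒ φ) ⇒ η ⇒ ψ)
  ⊨-s {η = η} {φ = φ} {ψ = ψ} .true-at w with ⟦ η ⟧ w | ⟦ φ ⟧ w
  ... | false | _     = refl
  ... | true  | false = refl
  ... | true  | true  = ∨-inverseˡ (⟦ ψ ⟧ w)

  ⊨-contra : ⊨ ((¬' φ ⇒ ¬' ψ) ⇒ (¬' φ ⇒ ψ) ⇒ φ)
  ⊨-contra {φ = φ} {ψ = ψ} .true-at w with ⟦ φ ⟧ w | ⟦ ψ ⟧ w
  ... | true  | _     = refl
  ... | false | true  = refl
  ... | false | false = refl

  ⊭⊥ : ¬ ⊨ ⊥'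
  ⊭⊥ ⊨⊥ with ⟦ atom zero ⟧ true | ⊨⊥ .true-at true
  ... | true  | ()
  ... | false | ()

  ⊨-d1 : ⊨ (φ ⇒ ψ) → ⊨ (¬' φ) ⊎ ⊨ (ψ ∣ φ)
  ⊨-d1 {φ = φ} {ψ = ψ} ⊨φ⇒ψ with ⟦ φ ⟧ true in φ-true | ⟦ φ ⟧ false in φ-false
  ... | true  | _     = inj₂ (everywhere λ w →
    ⇒-elim φ ψ (closest-satisfies ⟦ φ ⟧ true w φ-true) (⊨φ⇒ψ .true-at _))
  ... | false | true  = inj₂ (everywhere λ w →
    ⇒-elim φ ψ (closest-satisfies ⟦ φ ⟧ false w φ-false) (⊨φ⇒ψ .true-at _))
  ... | false | false = inj₁ (everywhere λ { true → cong not φ-true ; false → cong not φ-false })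

  ⊨-d3 : ⊨ ((ψ ∣ φ) ⇒ φ ⇒ ψ)
  ⊨-d3 {ψ = ψ} {φ = φ} .true-at w with ⟦ φ ⟧ w
  ... | true  = ∨-inverseˡ (⟦ ψ ⟧ w)
  ... | false = ∨-zeroʳ _

  ⊨×-complement : ∀ {φ ψ χ : Form n} → (∀ w → ⟦ χ ⟧ w ≡ not (⟦ φ ⟧ w))
                → ⊨ (ψ ×' χ) → ⊨ (ψ ×' φ)
  ⊨×-complement {φ} {ψ} {χ} χ≡¬φ ⊨ψ×χ .true-at w =
    ⇔-intro (ψ ∣ φ) ψ w (closest-complement ⟦ φ ⟧ ⟦ χ ⟧ ⟦ ψ ⟧ χ≡¬φ
                           (λ u → ⇔-elim (ψ ∣ χ) ψ u (⊨ψ×χ .true-at u)) w)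

  ⊨-axiom : DBLAx Γ Δ → All ⊨_ Γ → Any ⊨_ Δ
  ⊨-axiom (d1 φ ψ) (⊨φ⇒ψ ∷ []) = [ here , there ∘ here ]′ (⊨-d1 ⊨φ⇒ψ)
  ⊨-axiom (d2 φ ψ η) _ = here (everywhere λ w → ∨-inverseˡ (⟦ ψ ⇒ η ⟧ (closest ⟦ φ ⟧ w)))
  ⊨-axiom (d3 φ ψ) _ = here ⊨-d3
  ⊨-axiom (d4 φ ψ) _ = here (everywhere λ w →
    ⇔-intro (¬' ((¬' ψ) ∣ φ)) (ψ ∣ φ) w (not-involutive (⟦ ψ ⟧ (closest ⟦ φ ⟧ w))))
  ⊨-axiom (d5 φ ψ) (⊨ψ×¬φ ∷ []) = here (⊨×-complement (λ _ → refl) ⊨ψ×¬φ)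
  ⊨-axiom (d6 φ ψ) (⊨ψ×φ ∷ []) =
    here (⊨×-complement (λ w → sym (not-involutive (⟦ φ ⟧ w))) ⊨ψ×φ)
  ⊨-axiom (d7 φ ψ η) (⊨ψ⇔η ∷ []) = here (everywhere λ w →
    ⇔-intro (φ ∣ ψ) (φ ∣ η) w
      (cong ⟦ φ ⟧ (closest-cong (λ u → ⇔-elim ψ η u (⊨ψ⇔η .true-at u)) w)))

  isModel : IsModel DBLAx ⊨_
  isModel = record
    { ⊨-mp     = ⊨-mp
    ; ⊨-k      = ⊨-k
    ; ⊨-s      = ⊨-s
    ; ⊨-contra = ⊨-contra
    ; ⊭⊥       = ⊭⊥
    ; ⊨-axiom  = ⊨-axiom
    }

infix  3 _⊢_
infixl 6 _·_

data _⊢_ (Γ : List (Form n)) : Form n → Set where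
  hyp : φ ∈ Γ → Γ ⊢ φ
  K   : Γ ⊢ φ ⇒ ψ ⇒ φ
  S   : Γ ⊢ (η ⇒ φ ⇒ ψ) ⇒ (η ⇒ φ) ⇒ η ⇒ ψ
  C   : Γ ⊢ (¬' φ ⇒ ¬' ψ) ⇒ (¬' φ ⇒ ψ) ⇒ φ
  _·_ : Γ ⊢ φ ⇒ ψ → Γ ⊢ φ → Γ ⊢ ψ

⊢⇒Derivable : ∀ {Ax} → [] ⊢ φ → Derivable Ax [] (φ ∷ [])
⊢⇒Derivable (hyp ())
⊢⇒Derivable K = k _ _
⊢⇒Derivable S = s _ _ _
⊢⇒Derivable C = contra _ _
⊢⇒Derivable (_·_ {φ = φ} {ψ = ψ} ⊢φ⇒ψ ⊢φ) =
  cut {Γ = []} {Δ = []} {Λ = []} φ (⊢⇒Derivable ⊢φ)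
    (cut {Γ = []} {Δ = []} {Λ = φ ∷ []} (φ ⇒ ψ) (⊢⇒Derivable ⊢φ⇒ψ) (mp φ ψ))

h₀ : φ ∷ Γ ⊢ φ
h₀ = hyp (here refl)

h₁ : ψ ∷ φ ∷ Γ ⊢ φ
h₁ = hyp (there (here refl))

⇒-refl : Γ ⊢ φ ⇒ φ
⇒-refl {φ = φ} = S · K · K {ψ = φ}

deduction : φ ∷ Γ ⊢ ψ → Γ ⊢ φ ⇒ ψ
deduction (hyp (here refl)) = ⇒-refl
deduction (hyp (there ψ∈Γ)) = K · hyp ψ∈Γ
deduction K = K · K
deduction S = K · S
deduction C = K · C
deduction (d · e) = S · deduction d · deduction e

¬¬-elim : Γ ⊢ ¬' ¬' φ ⇒ φ
¬¬-elim = deduction (C · (K · h₀) · ⇒-refl)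

¬¬-intro : Γ ⊢ φ ⇒ ¬' ¬' φ
¬¬-intro = deduction (C · ¬¬-elim · (K · h₀))

explosion : Γ ⊢ ¬' φ ⇒ φ ⇒ ψ
explosion = deduction (deduction (C · (K · h₁) · (K · h₀)))

contraposition : Γ ⊢ (¬' ψ ⇒ ¬' φ) ⇒ φ ⇒ ψ
contraposition = deduction (deduction (C · h₁ · (K · h₀)))

contrapositive : Γ ⊢ (φ ⇒ ψ) ⇒ ¬' ψ ⇒ ¬' φ
contrapositive = deduction (contraposition · deduction (¬¬-intro · (h₁ · (¬¬-elim · h₀))))

¬⇒-intro : Γ ⊢ φ ⇒ ¬' ψ ⇒ ¬' (φ ⇒ ψ)
¬⇒-intro = deduction (contrapositive · deduction (h₀ · h₁))

by-cases : Γ ⊢ (φ ⇒ ψ) ⇒ (¬' φ ⇒ ψ) ⇒ ψ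
by-cases = deduction (deduction (C · (contrapositive · h₀) · (contrapositive · h₁)))

literal : Bool → Form n → Form n
literal b φ = if b then φ else ¬' φ

literals : Valuation n → List (Fin (suc n)) → List (Form n)
literals v = map (λ i → literal (lookup v i) (atom i))

kalmar : ∀ v (c : Classical φ) → literals v (allFin _) ⊢ literal (eval v c) φ
kalmar v (atom i) = hyp (∈-map⁺ _ (∈-allFin i))
kalmar v (neg c) with eval v c | kalmar v c
... | true  | ⊢φ  = ¬¬-intro · ⊢φ
... | false | ⊢¬φ = ⊢¬φ
kalmar v (imp c d) with eval v c | kalmar v c | eval v d | kalmar v d
... | false | ⊢¬φ | _     | _   = explosion · ⊢¬φ
... | true  | _   | true  | ⊢ψ  = K · ⊢ψ
... | true  | ⊢φ  | false | ⊢¬ψ = ¬⇒-intro · ⊢φ · ⊢¬ψ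

literals-update : ∀ {i : Fin (suc n)} {L} v b → All (i ≢_) L
                → literals (v [ i ]≔ b) L ≡ literals v L
literals-update v b []           = refl
literals-update {L = j ∷ L} v b (i≢j ∷ i∉L) =
  cong₂ _∷_ (cong (λ b′ → literal b′ (atom j)) (lookup∘update′ (i≢j ∘ sym) v b))
            (literals-update v b i∉L)

eliminate-literals : ∀ {L} → Unique L → (∀ v → literals v L ⊢ φ) → [] ⊢ φ
eliminate-literals []            ⊢φ = ⊢φ (replicate _ true)
eliminate-literals {φ = φ} {L = i ∷ L} (i∉L ∷ unique) ⊢φ =
  eliminate-literals unique λ v →
    by-cases · deduction (assume-i v true) · deduction (assume-i v false)
  where
    assume-i : ∀ v b → literal b (atom i) ∷ literals v L ⊢ φ
    assume-i v b = subst (_⊢ φ)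
      (cong₂ _∷_ (cong (λ b′ → literal b′ (atom i)) (lookup∘update i v b))
                 (literals-update v b i∉L))
      (⊢φ (v [ i ]≔ b))

completeness : ∀ {Ax} (c : Classical φ) → (∀ v → eval v c ≡ true) → Derivable Ax [] (φ ∷ [])
completeness {φ = φ} c tautology = ⊢⇒Derivable (eliminate-literals (allFin⁺ _) λ v →
  subst (λ b → _ ⊢ literal b φ) (tautology v) (kalmar v c))

-- A valuation is a `Subset (suc n)`, so `anySubset?` searches through all of them.
tautology-or-refutable : (c : Classical φ)
                       → (∀ v → eval v c ≡ true) ⊎ ∃ λ v → eval v c ≡ false
tautology-or-refutable c with anySubset? (λ v → eval v c ≟ᵇ false)
... | yes refutation = inj₂ refutation
... | no ¬refutation  = inj₁ λ v → ¬-not λ φ-false → ¬refutation (v , φ-false)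

classical-disjunction : ∀ {φ ψ : Form n} (cφ : Classical φ) (cψ : Classical ψ)
                      → [] ⊢DBL (φ ∷ ψ ∷ []) → ∀ u v → eval u cφ ≡ true ⊎ eval v cψ ≡ true
classical-disjunction {φ = φ} {ψ} cφ cψ ⊢φ,ψ u v =
  true-at-its-world (soundness isModel ⊢φ,ψ [])
  where
    open TwoWorlds (λ w → if w then u else v)
    true-at-its-world : Any ⊨_ (φ ∷ ψ ∷ []) → eval u cφ ≡ true ⊎ eval v cψ ≡ true
    true-at-its-world (here ⊨φ) =
      inj₁ (trans (sym (⟦⟧-classical cφ true)) (⊨φ .true-at true))
    true-at-its-world (there (here ⊨ψ)) =
      inj₂ (trans (sym (⟦⟧-classical cψ false)) (⊨ψ .true-at false))

proposition7 : (n : ℕ) (φ ψ : Form n) → Classical φ → Classical ψ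
               → [] ⊢DBL (φ ∷ ψ ∷ [])
               → ([] ⊢C (φ ∷ [])) ⊎ ([] ⊢C (ψ ∷ []))
proposition7 n φ ψ cφ cψ ⊢φ,ψ with tautology-or-refutable cφ
... | inj₁ φ-tautology        = inj₁ (completeness cφ φ-tautology)
... | inj₂ (u , φ-false-at-u) = inj₂ (completeness cψ ψ-tautology)
  where
    ψ-tautology : ∀ v → eval v cψ ≡ true
    ψ-tautology v with classical-disjunction cφ cψ ⊢φ,ψ u v
    ... | inj₁ φ-true-at-u = contradiction (trans (sym φ-true-at-u) φ-false-at-u) λ ()
    ... | inj₂ ψ-true-at-v = ψ-true-at-v
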